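{- If $G$ is a simple oriented hypergraph with vertex set $V=\{v_1,\dots,v_n\}$, then $L_G=-W_{(G,V,V,1)}$.
   Context: An oriented hypergraph $G=(V,E,\mathcal{I},\sigma)$ consists of disjoint finite sets $V$, $E$, an incidence function $\iota:V\times E\to\mathbb{Z}_{\ge0}$, incidences $(v,e,k)$ with $1\le k\le\iota(v,e)$, and $\sigma:\mathcal{I}\to\{+1,-1\}$. Simple means $\iota(v,e)\le1$; write $(v,e)$ for $(v,e,1)$. For simple $G$: $sgn_e(v,w)=-\sigma(v,e)\sigma(w,e)$ if $(v,e),(w,e)$ are distinct incidences and $0$ otherwise; $A_G=[a_{ij}]$, $a_{ij}=\sum_e sgn_e(v_i,v_j)$; $D_G=\mathrm{diag}(\deg v_1,\dots,\deg v_n)$ with $\deg v$ the number of incidences containing $v$; $L_G=D_G-A_G$. A weak walk is a sequence $W=a_0,i_1,a_1,\dots,i_n,a_n$ where $a_0,\dots,a_n$ alternate between vertices and edges and each $i_h$ is an incidence containing $a_{h-1}$ and $a_h$ (repetition $i_{2h-1}=i_{2h}$ allowed); its length is $n/2$ and its sign is $(-1)^{\lfloor n/2\rfloor}\prod_{h=1}^n\sigma(i_h)$. $\widetilde{w}^{\pm}(a,b;k)$ is the number of positive weak walks of length $k$ from $a$ to $b$ minus the number of negative ones. The weak walk matrix $W_{(G,V,V,1)}$ is the $V\times V$ matrix with $(i,j)$-entry $\widetilde{w}^{\pm}(v_i,v_j;1)$. -}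

module Defs where

open import Data.Nat as ℕ using (ℕ; zero; suc)
open import Data.Nat.DivMod using (_/_)
open import Data.Integer as ℤ using (ℤ)
open import Data.Fin as Fin using (Fin)
open import Data.Fin.Properties using () renaming (_≟_ to _≟F_)
open import Data.List as List using (List; []; _∷_; allFin; concatMap; filter; length)
open import Data.Sign as S using (Sign)
open import Data.Sign.Properties using () renaming (_≟_ to _≟S_)
open import Relation.Nullary using (yes; no)
open import Relation.Binary.PropositionalEquality using (_≡_)

-- An oriented hypergraph with vertex set V = Fin n (v_i ↦ i) and edge set E = Fin m.
-- ι v e is the incidence multiplicity; the incidences (v,e,k), 1 ≤ k ≤ ι v e,
-- are indexed by k-1 : Fin (ι v e); σ assigns each incidence a sign.
record OHG (n m : ℕ) : Set where
  field
    ι : Fin n → Fin m → ℕ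
    σ : (v : Fin n) (e : Fin m) → Fin (ι v e) → Sign
open OHG public

IsSimple : ∀ {n m} → OHG n m → Set
IsSimple {n} {m} G = ∀ (v : Fin n) (e : Fin m) → ι G v e ℕ.≤ 1

Σℕ : ∀ k → (Fin k → ℕ) → ℕ
Σℕ k f = List.foldr ℕ._+_ 0 (List.map f (allFin k))

Σℤ : ∀ k → (Fin k → ℤ) → ℤ
Σℤ k f = List.foldr ℤ._+_ (ℤ.+ 0) (List.map f (allFin k))

signℤ : Sign → ℤ
signℤ S.+ = ℤ.+ 1
signℤ S.- = ℤ.-[1+ 0 ]

module _ {n m : ℕ} (G : OHG n m) where

  deg : Fin n → ℕ
  deg v = Σℕ m (λ e → ι G v e)

  -- sgn_e(v,w) for a simple hypergraph: (v,e) = (v,e,1) and (w,e) = (w,e,1);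
  -- -σ(v,e)σ(w,e) if these are distinct incidences (i.e. both exist and v ≠ w), else 0.
  private
    sgnAux : (a b : ℕ) → (Fin a → Sign) → (Fin b → Sign) → ℤ
    sgnAux (suc _) (suc _) s t = ℤ.- signℤ (s Fin.zero S.* t Fin.zero)
    sgnAux _ _ _ _ = ℤ.+ 0

  sgn : Fin m → Fin n → Fin n → ℤ
  sgn e v w with v ≟F w
  ... | yes _ = ℤ.+ 0
  ... | no _  = sgnAux (ι G v e) (ι G w e) (σ G v e) (σ G w e)

  AdjMat : Fin n → Fin n → ℤ
  AdjMat i j = Σℤ m (λ e → sgn e i j)

  DegMat : Fin n → Fin n → ℤ
  DegMat i j with i ≟F j
  ... | yes _ = ℤ.+ deg i
  ... | no _  = ℤ.+ 0

  Laplacian : Fin n → Fin n → ℤ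
  Laplacian i j = DegMat i j ℤ.- AdjMat i j

  -- Weak walks from vertex v to vertex w with k edge-steps:
  -- v = a₀, i₁, a₁ = e, i₂, a₂ = u, … ; each step passes through an edge e
  -- using an incidence (v,e,·) and an incidence (u,e,·) (they may coincide).
  data WeakWalk : Fin n → Fin n → Set where
    stop : ∀ {v} → WeakWalk v v
    step : ∀ {v u w} (e : Fin m) → Fin (ι G v e) → Fin (ι G u e) → WeakWalk u w → WeakWalk v w

  incSigns : ∀ {v w} → WeakWalk v w → List Sign
  incSigns stop = []
  incSigns (step {v} {u} e i j W) = σ G v e i ∷ σ G u e j ∷ incSigns W

  walkLength : ∀ {v w} → WeakWalk v w → ℕ
  walkLength W = length (incSigns W) / 2

  negPow : ℕ → Sign
  negPow zero = S.+
  negPow (suc k) = S.- S.* negPow k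

  walkSign : ∀ {v w} → WeakWalk v w → Sign
  walkSign W = negPow (length (incSigns W) / 2) S.* List.foldr S._*_ S.+ (incSigns W)

  walks : (k : ℕ) → (v w : Fin n) → List (WeakWalk v w)
  walks zero v w with v ≟F w
  ... | yes _≡_.refl = stop ∷ []
  ... | no _ = []
  walks (suc k) v w =
    concatMap (λ u → concatMap (λ e → concatMap (λ i → concatMap (λ j →
      List.map (step e i j) (walks k u w))
      (allFin (ι G u e))) (allFin (ι G v e))) (allFin m)) (allFin n)

  wtilde : Fin n → Fin n → ℕ → ℤ
  wtilde v w k =
    ℤ.+ length (filter (λ W → walkSign W ≟S S.+) (walks k v w))
    ℤ.- ℤ.+ length (filter (λ W → walkSign W ≟S S.-) (walks k v w))

  WeakWalkMat1 : Fin n → Fin n → ℤ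
  WeakWalkMat1 i j = wtilde i j 1

module Submission where

-- Both sides are computed edge by edge.  A weak walk of length one from v to w
-- is a choice of an edge e, an incidence (v,e,i) and an incidence (w,e,j); its
-- sign is (-1)^1 σ(v,e,i) σ(w,e,j).  Writing pairSum for the sum of these signs
-- over the incidence pairs at a fixed edge, we show
--   (1) W_(G,V,V,1)(v,w) = Σ_e pairSum(v,w,e), by counting signed walks as a
--       sum of signs, unfolding the enumeration `walks`, and collapsing the sum
--       over the intermediate vertex (a zero-step walk u → w exists iff u = w);
--   (2) L_G(v,w) = - Σ_e pairSum(v,w,e), since for a simple hypergraph
--       pairSum(v,v,e) = -ι(v,e) (so the diagonal recovers deg v) and
--       pairSum(v,w,e) = sgn_e(v,w) for v ≠ w.

open import Defs
open import Data.Nat using (ℕ)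
open import Data.Fin using (Fin)
open import Data.Integer using (-_)
open import Relation.Binary.PropositionalEquality using (_≡_)

open import Data.Nat as ℕ using (zero; suc; s≤s)
open import Data.Integer as ℤ using (ℤ; +_; _+_; _-_)
import Data.Integer.Properties as ℤP
open import Data.Integer.Tactic.RingSolver using (solve-∀)
open import Data.Fin as Fin using ()
open import Data.Fin.Properties using () renaming (_≟_ to _≟F_)
open import Data.List as List using (List; []; _∷_; allFin; concatMap; filter; length; map; _++_)
open import Data.List.Properties using (map-++; map-tabulate)
open import Data.Sign as S using (Sign)
open import Data.Sign.Properties using () renaming (_≟_ to _≟S_)
open import Relation.Nullary using (Dec; yes; no; ¬_)
open import Relation.Binary.PropositionalEquality
  using (refl; sym; trans; cong; cong₂; module ≡-Reasoning)
open import Data.Empty using (⊥-elim)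

-- Sum of a list of integers; Σℤ k f is definitionally sumℤ (map f (allFin k)).
sumℤ : List ℤ → ℤ
sumℤ = List.foldr _+_ (+ 0)

sum-++ : ∀ xs ys → sumℤ (xs ++ ys) ≡ sumℤ xs + sumℤ ys
sum-++ []       ys = sym (ℤP.+-identityˡ _)
sum-++ (x ∷ xs) ys = trans (cong (_+_ x) (sum-++ xs ys)) (sym (ℤP.+-assoc x _ _))

sum-concatMap : ∀ {A B : Set} (F : B → ℤ) (g : A → List B) xs →
  sumℤ (map F (concatMap g xs)) ≡ sumℤ (map (λ x → sumℤ (map F (g x))) xs)
sum-concatMap F g []       = refl
sum-concatMap F g (x ∷ xs) = begin
    sumℤ (map F (g x ++ concatMap g xs))
  ≡⟨ cong sumℤ (map-++ F (g x) (concatMap g xs)) ⟩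
    sumℤ (map F (g x) ++ map F (concatMap g xs))
  ≡⟨ sum-++ (map F (g x)) (map F (concatMap g xs)) ⟩
    sumℤ (map F (g x)) + sumℤ (map F (concatMap g xs))
  ≡⟨ cong (_+_ (sumℤ (map F (g x)))) (sum-concatMap F g xs) ⟩
    sumℤ (map F (g x)) + sumℤ (map (λ y → sumℤ (map F (g y))) xs)
  ∎
  where open ≡-Reasoning

sum-cong : ∀ {A : Set} {f g : A → ℤ} → (∀ x → f x ≡ g x) →
  ∀ xs → sumℤ (map f xs) ≡ sumℤ (map g xs)
sum-cong h []       = refl
sum-cong h (x ∷ xs) = cong₂ _+_ (h x) (sum-cong h xs)

sum-zero : ∀ {A : Set} {f : A → ℤ} → (∀ x → f x ≡ + 0) → ∀ xs → sumℤ (map f xs) ≡ + 0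
sum-zero h []       = refl
sum-zero h (x ∷ xs) = cong₂ _+_ (h x) (sum-zero h xs)

neg-sum : ∀ {A : Set} (f : A → ℤ) xs → - sumℤ (map f xs) ≡ sumℤ (map (λ x → - f x) xs)
neg-sum f []       = refl
neg-sum f (x ∷ xs) = trans (ℤP.neg-distrib-+ (f x) _) (cong (_+_ (- f x)) (neg-sum f xs))

+-Σℕ : ∀ k (f : Fin k → ℕ) → + Σℕ k f ≡ Σℤ k (λ x → + f x)
+-Σℕ k f = go (allFin k)
  where
  go : ∀ xs → + List.foldr ℕ._+_ 0 (map f xs) ≡ sumℤ (map (λ x → + f x) xs)
  go []       = refl
  go (x ∷ xs) = cong (_+_ (+ f x)) (go xs)

Σℤ-suc : ∀ k (f : Fin (suc k) → ℤ) → Σℤ (suc k) f ≡ f Fin.zero + Σℤ k (λ x → f (Fin.suc x))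
Σℤ-suc k f = cong (λ xs → f Fin.zero + sumℤ xs)
  (trans (map-tabulate Fin.suc f) (sym (map-tabulate (λ x → x) (λ x → f (Fin.suc x)))))

Σℤ-single : ∀ k (w : Fin k) (f : Fin k → ℤ) → (∀ u → ¬ u ≡ w → f u ≡ + 0) → Σℤ k f ≡ f w
Σℤ-single (suc k) Fin.zero f vanish = begin
    Σℤ (suc k) f
  ≡⟨ Σℤ-suc k f ⟩
    f Fin.zero + Σℤ k (λ u → f (Fin.suc u))
  ≡⟨ cong (_+_ (f Fin.zero)) (sum-zero (λ u → vanish (Fin.suc u) (λ ())) (allFin k)) ⟩
    f Fin.zero + + 0
  ≡⟨ ℤP.+-identityʳ _ ⟩
    f Fin.zero
  ∎
  where open ≡-Reasoning
Σℤ-single (suc k) (Fin.suc w) f vanish = begin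
    Σℤ (suc k) f
  ≡⟨ Σℤ-suc k f ⟩
    f Fin.zero + Σℤ k (λ u → f (Fin.suc u))
  ≡⟨ cong₂ _+_ (vanish Fin.zero (λ ())) (Σℤ-single k w _ (λ u u≢w → vanish (Fin.suc u) (λ { refl → u≢w refl }))) ⟩
    + 0 + f (Fin.suc w)
  ≡⟨ ℤP.+-identityˡ _ ⟩
    f (Fin.suc w)
  ∎
  where open ≡-Reasoning

signedCount : ∀ {A : Set} (s : A → Sign) (xs : List A) →
  + length (filter (λ x → s x ≟S S.+) xs) - + length (filter (λ x → s x ≟S S.-) xs)
  ≡ sumℤ (map (λ x → signℤ (s x)) xs)
signedCount s []       = refl
signedCount s (x ∷ xs) with s x
... | S.+ = trans (shift (+ length (filter (λ y → s y ≟S S.+) xs)) (+ length (filter (λ y → s y ≟S S.-) xs)))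
                  (cong (_+_ (+ 1)) (signedCount s xs))
  where
  shift : ∀ (p q : ℤ) → (+ 1 + p) - q ≡ + 1 + (p - q)
  shift = solve-∀
... | S.- = trans (shift (+ length (filter (λ y → s y ≟S S.+) xs)) (+ length (filter (λ y → s y ≟S S.-) xs)))
                  (cong (_+_ (ℤ.-[1+ 0 ])) (signedCount s xs))
  where
  shift : ∀ (p q : ℤ) → p - (+ 1 + q) ≡ ℤ.-[1+ 0 ] + (p - q)
  shift = solve-∀

-- Signed count of ordered pairs (i, j) of incidences, weighted by -s(i)t(j):
-- the contribution of one edge to a signed count of one-step walks.
pairSum : ∀ a b → (Fin a → Sign) → (Fin b → Sign) → ℤ
pairSum a b s t = Σℤ a λ i → Σℤ b λ j → - signℤ (s i S.* t j)

-- With at most one incidence, pairing it with itself yields -a (note s * s = +).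
pairSum-self : ∀ a (s : Fin a → Sign) → a ℕ.≤ 1 → + a ≡ - pairSum a a s s
pairSum-self zero          s _           = refl
pairSum-self (suc zero)    s _ with s Fin.zero
... | S.+ = refl
... | S.- = refl
pairSum-self (suc (suc a)) s (s≤s ())

module WalkSide {n m : ℕ} (G : OHG n m) where

  sg : ∀ {v w} → WeakWalk G v w → ℤ
  sg W = signℤ (walkSign G W)

  oneStepSign : ∀ {v w} (e : Fin m) (i : Fin (ι G v e)) (j : Fin (ι G w e)) →
    sg (step e i j stop) ≡ - signℤ (σ G v e i S.* σ G w e j)
  oneStepSign {v} {w} e i j with σ G v e i | σ G w e j
  ... | S.+ | S.+ = refl
  ... | S.+ | S.- = refl
  ... | S.- | S.+ = refl
  ... | S.- | S.- = refl

  walks-zero-self : ∀ v → walks G 0 v v ≡ stop ∷ []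
  walks-zero-self v with v ≟F v
  ... | yes refl = refl
  ... | no v≢v   = ⊥-elim (v≢v refl)

  walks-zero-other : ∀ {u w} → ¬ u ≡ w → walks G 0 u w ≡ []
  walks-zero-other {u} {w} u≢w with u ≟F w
  ... | yes u≡w = ⊥-elim (u≢w u≡w)
  ... | no _    = refl

  viaVertex : (v w u : Fin n) → ℤ
  viaVertex v w u = Σℤ m λ e → Σℤ (ι G v e) λ i → Σℤ (ι G u e) λ j →
                      sumℤ (map sg (map (step e i j) (walks G 0 u w)))

  walks-one-expand : ∀ v w → sumℤ (map sg (walks G 1 v w)) ≡ Σℤ n (viaVertex v w)
  walks-one-expand v w =
    trans (sum-concatMap sg _ (allFin n)) (sum-cong (λ u →
      trans (sum-concatMap sg _ (allFin m)) (sum-cong (λ e →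
        trans (sum-concatMap sg _ (allFin (ι G v e))) (sum-cong (λ i →
          sum-concatMap sg _ (allFin (ι G u e))) (allFin (ι G v e)))) (allFin m))) (allFin n))

  viaVertex-other : ∀ v w u → ¬ u ≡ w → viaVertex v w u ≡ + 0
  viaVertex-other v w u u≢w =
    sum-zero (λ e → sum-zero (λ i → sum-zero (λ j →
      cong (λ L → sumℤ (map sg (map (step e i j) L))) (walks-zero-other u≢w))
      (allFin (ι G u e))) (allFin (ι G v e))) (allFin m)

  viaVertex-self : ∀ v w → viaVertex v w w ≡ Σℤ m (λ e → pairSum (ι G v e) (ι G w e) (σ G v e) (σ G w e))
  viaVertex-self v w =
    sum-cong (λ e → sum-cong (λ i → sum-cong (λ j → begin
        sumℤ (map sg (map (step e i j) (walks G 0 w w)))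
      ≡⟨ cong (λ L → sumℤ (map sg (map (step e i j) L))) (walks-zero-self w) ⟩
        sg (step e i j stop) + + 0
      ≡⟨ ℤP.+-identityʳ _ ⟩
        sg (step e i j stop)
      ≡⟨ oneStepSign e i j ⟩
        - signℤ (σ G v e i S.* σ G w e j)
      ∎) (allFin (ι G w e))) (allFin (ι G v e))) (allFin m)
    where open ≡-Reasoning

  weakWalkMat1-edgeSum : ∀ v w →
    WeakWalkMat1 G v w ≡ Σℤ m (λ e → pairSum (ι G v e) (ι G w e) (σ G v e) (σ G w e))
  weakWalkMat1-edgeSum v w = begin
      WeakWalkMat1 G v w
    ≡⟨ signedCount (walkSign G) (walks G 1 v w) ⟩
      sumℤ (map sg (walks G 1 v w))
    ≡⟨ walks-one-expand v w ⟩
      Σℤ n (viaVertex v w)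
    ≡⟨ Σℤ-single n w (viaVertex v w) (viaVertex-other v w) ⟩
      viaVertex v w w
    ≡⟨ viaVertex-self v w ⟩
      Σℤ m (λ e → pairSum (ι G v e) (ι G w e) (σ G v e) (σ G w e))
    ∎
    where open ≡-Reasoning

module LaplacianSide {n m : ℕ} (G : OHG n m) (simple : IsSimple G) where

  edgePairs : Fin n → Fin n → Fin m → ℤ
  edgePairs v w e = pairSum (ι G v e) (ι G w e) (σ G v e) (σ G w e)

  sgn-offDiag : ∀ {v w} (e : Fin m) → ¬ v ≡ w → sgn G e v w ≡ edgePairs v w e
  sgn-offDiag {v} {w} e v≢w with v ≟F w
  ... | yes v≡w = ⊥-elim (v≢w v≡w)
  ... | no _ with ι G v e | σ G v e | simple v e | ι G w e | σ G w e | simple w e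
  ...   | zero          | _ | _        | _             | _ | _        = refl
  ...   | suc zero      | _ | _        | zero          | _ | _        = refl
  ...   | suc zero      | _ | _        | suc zero      | _ | _        =
          sym (trans (ℤP.+-identityʳ _) (ℤP.+-identityʳ _))
  ...   | suc zero      | _ | _        | suc (suc _)   | _ | s≤s ()
  ...   | suc (suc _)   | _ | s≤s () | _             | _ | _

  sgn-diag : ∀ v (e : Fin m) → sgn G e v v ≡ + 0
  sgn-diag v e with v ≟F v
  ... | yes _  = refl
  ... | no v≢v = ⊥-elim (v≢v refl)

  degMat-diag : ∀ v → DegMat G v v ≡ + deg G v
  degMat-diag v with v ≟F v
  ... | yes _  = refl
  ... | no v≢v = ⊥-elim (v≢v refl)

  degMat-offDiag : ∀ {v w} → ¬ v ≡ w → DegMat G v w ≡ + 0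
  degMat-offDiag {v} {w} v≢w with v ≟F w
  ... | yes v≡w = ⊥-elim (v≢w v≡w)
  ... | no _    = refl

  laplacian-diag : ∀ v → Laplacian G v v ≡ - Σℤ m (edgePairs v v)
  laplacian-diag v = begin
      DegMat G v v - AdjMat G v v
    ≡⟨ cong₂ _-_ (degMat-diag v) (sum-zero (sgn-diag v) (allFin m)) ⟩
      + deg G v - + 0
    ≡⟨ ℤP.+-identityʳ _ ⟩
      + Σℕ m (ι G v)
    ≡⟨ +-Σℕ m (ι G v) ⟩
      Σℤ m (λ e → + ι G v e)
    ≡⟨ sum-cong (λ e → pairSum-self (ι G v e) (σ G v e) (simple v e)) (allFin m) ⟩
      Σℤ m (λ e → - edgePairs v v e)
    ≡⟨ sym (neg-sum (edgePairs v v) (allFin m)) ⟩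
      - Σℤ m (edgePairs v v)
    ∎
    where open ≡-Reasoning

  laplacian-offDiag : ∀ {v w} → ¬ v ≡ w → Laplacian G v w ≡ - Σℤ m (edgePairs v w)
  laplacian-offDiag {v} {w} v≢w = begin
      DegMat G v w - AdjMat G v w
    ≡⟨ cong₂ _-_ (degMat-offDiag v≢w) (sum-cong (λ e → sgn-offDiag e v≢w) (allFin m)) ⟩
      + 0 - Σℤ m (edgePairs v w)
    ≡⟨ ℤP.+-identityˡ _ ⟩
      - Σℤ m (edgePairs v w)
    ∎
    where open ≡-Reasoning

  laplacian-edgeSum : ∀ v w → Laplacian G v w ≡ - Σℤ m (edgePairs v w)
  laplacian-edgeSum v w = byCases (v ≟F w)
    where
    byCases : Dec (v ≡ w) → Laplacian G v w ≡ - Σℤ m (edgePairs v w)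
    byCases (yes refl) = laplacian-diag v
    byCases (no v≢w)   = laplacian-offDiag v≢w

theorem5p8 : ∀ {n m : ℕ} (G : OHG n m) → IsSimple G →
    ∀ (i j : Fin n) → Laplacian G i j ≡ - WeakWalkMat1 G i j
theorem5p8 G simple i j =
  trans (LaplacianSide.laplacian-edgeSum G simple i j)
        (cong -_ (sym (WalkSide.weakWalkMat1-edgeSum G i j)))
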